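{- For all modal trees $\mathtt{T},\mathtt{S}$: if $\mathtt{T}\hookrightarrow^{*}\mathtt{S}$, then $\mathtt{T}\hookrightarrow^{\Omega}\mathtt{S}$ for some normal rewriting sequence $\Omega$.
   Context: Modal trees: recursively, pairs $\langle\Delta;\Gamma\rangle$ with $\Delta$ a finite list of propositional variables and $\Gamma$ a finite list of pairs $(\alpha,\mathtt{S})$, $\alpha<\omega$, $\mathtt{S}$ a modal tree. Positions: $\mathrm{Pos}(\langle\Delta;\varnothing\rangle)=\{\epsilon\}$; $\mathrm{Pos}(\langle\Delta;[(\alpha_1,\mathtt{S}_1),\dots,(\alpha_n,\mathtt{S}_n)]\rangle)=\{\epsilon\}\cup\bigcup_{i=1}^n\{i\mathbf{k}\mid\mathbf{k}\in\mathrm{Pos}(\mathtt{S}_i)\}$. Subtree: $\mathtt{T}|_\epsilon=\mathtt{T}$, $\mathtt{T}|_{i\mathbf{r}}=\mathtt{S}_i|_{\mathbf{r}}$. Replacement: $\mathtt{T}[\mathtt{S}]_\epsilon=\mathtt{S}$, $\mathtt{T}[\mathtt{S}]_{i\mathbf{r}}$ is $\mathtt{T}$ with its $i$-th child $\mathtt{S}_i$ replaced by $\mathtt{S}_i[\mathtt{S}]_{\mathbf{r}}$ (same edge label). List operations, for $0<i,j\le|\Gamma|$: $\#_i\Gamma$ is the $i$-th element; $\Gamma^{ -i}$ deletes it; $\Gamma^{+i}=(\#_i\Gamma)\frown\Gamma$; $\Gamma[x]_i$ replaces the $i$-th element by $x$; $\Gamma^{i\leftrightarrow j}$ swaps the $i$-th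 and $j$-th elements; similarly $\Delta^{ -n},\Delta^{+n}$. Rewriting rules of $\mathsf{TRC}$: for a modal tree $\mathtt{T}$, $\mathbf{k}\in\mathrm{Pos}(\mathtt{T})$ with $\mathtt{T}|_\mathbf{k}=\langle\Delta;\Gamma\rangle$: ($\rho^+$) $\mathtt{T}\hookrightarrow\mathtt{T}[\langle\Delta^{+i};\Gamma\rangle]_\mathbf{k}$, $0<i\le|\Delta|$; ($\rho^-$) $\mathtt{T}\hookrightarrow\mathtt{T}[\langle\Delta^{ -i};\Gamma\rangle]_\mathbf{k}$; ($\sigma$) $\mathtt{T}\hookrightarrow\mathtt{T}[\langle\Delta;\Gamma^{i\leftrightarrow j}\rangle]_\mathbf{k}$, $i\neq j$; ($\pi^+$) $\mathtt{T}\hookrightarrow\mathtt{T}[\langle\Delta;\Gamma^{+i}\rangle]_\mathbf{k}$; ($\pi^-$) $\mathtt{T}\hookrightarrow\mathtt{T}[\langle\Delta;\Gamma^{ -i}\rangle]_\mathbf{k}$; ($\mathfrak{4}$) if $\#_i\Gamma=(\beta,\langle\tilde\Delta;\tilde\Gamma\rangle)$ and $\#_j\tilde\Gamma=(\beta,\mathtt{S})$, then $\mathtt{T}\hookrightarrow\mathtt{T}[\langle\Delta;\Gamma[(\beta,\mathtt{S})]_i\rangle]_\mathbf{k}$; ($\lambda$) if $\#_i\Gamma=(\alpha,\mathtt{S})$ and $\alpha>\beta$, then $\mathtt{T}\hookrightarrow\mathtt{T}[\langle\Delta;\Gamma[(\beta,\mathtt{S})]_i\rangle]_\mathbf{k}$;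 ($\mathsf{J}$) if $i\ne j$, $\#_i\Gamma=(\alpha,\langle\tilde\Delta;\tilde\Gamma\rangle)$, $\#_j\Gamma=(\beta,\mathtt{S})$, $\alpha>\beta$, then $\mathtt{T}\hookrightarrow\mathtt{T}[\langle\Delta;(\Gamma[(\alpha,\langle\tilde\Delta;\tilde\Gamma\frown(\beta,\mathtt{S})\rangle)]_i)^{ -j}\rangle]_\mathbf{k}$. $\hookrightarrow$ is the union of these relations, $\hookrightarrow^*$ its reflexive-transitive closure. Kinds: atomic $=\{\rho^+,\rho^-\}$, structural $=\{\sigma\}$, replicative $=\{\pi^+\}$, decreasing $=\{\pi^-,\mathfrak{4}\}$, modal $=\{\lambda,\mathsf{J}\}$. For a list $\Omega$ of rules, $\mathtt{T}\hookrightarrow^{\Omega}\mathtt{S}$ means: $\mathtt{S}=\mathtt{T}$ if $\Omega=\varnothing$, and $\mathtt{T}\hookrightarrow^{\mu}\mathtt{U}\hookrightarrow^{\hat\Omega}\mathtt{S}$ for some $\mathtt{U}$ if $\Omega=\mu\frown\hat\Omega$. A normal rewriting sequence is a list $\Omega_{\pi^+}\frown\Omega_\diamond\frown\Omega_\delta\frown\Omega_\rho\frown\Omega_\sigma$ where these are lists of replicative, modal, decreasing, atomic and structural rules respectively. -}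

module Defs where

open import Data.Nat using (ℕ; zero; suc; _<_)
open import Data.List using (List; []; _∷_; _++_)
open import Data.List.Relation.Unary.All using (All)
open import Data.Maybe using (Maybe; just; nothing)
open import Data.Product using (_×_; _,_; Σ; ∃; ∃-syntax)
open import Relation.Binary.PropositionalEquality using (_≡_; _≢_)
open import Relation.Binary.Construct.Closure.ReflexiveTransitive using (Star)

PropVar : Set
PropVar = ℕ

data MTree : Set where
  node : List PropVar → List (ℕ × MTree) → MTree

-- #_i Γ : the i-th element (1-indexed); nothing if i is out of range.
-- A hypothesis  nth Γ i ≡ just x  therefore also encodes 0 < i ≤ |Γ|.
nth : {A : Set} → List A → ℕ → Maybe A
nth []       _             = nothing
nth (x ∷ xs) zero          = nothing
nth (x ∷ xs) (suc zero)    = just x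
nth (x ∷ xs) (suc (suc i)) = nth xs (suc i)

del : {A : Set} → List A → ℕ → List A
del []       _             = []
del (x ∷ xs) zero          = x ∷ xs
del (x ∷ xs) (suc zero)    = xs
del (x ∷ xs) (suc (suc i)) = x ∷ del xs (suc i)

set : {A : Set} → List A → ℕ → A → List A
set []       _             y = []
set (x ∷ xs) zero          y = x ∷ xs
set (x ∷ xs) (suc zero)    y = y ∷ xs
set (x ∷ xs) (suc (suc i)) y = x ∷ set xs (suc i) y

data Rule : Set where
  ρ⁺ ρ⁻ σ π⁺ π⁻ 𝔯4 λ' J : Rule

data RootStep : Rule → MTree → MTree → Set where
  ρ⁺-step : ∀ {Δ Γ i p} → nth Δ i ≡ just p →
            RootStep ρ⁺ (node Δ Γ) (node (p ∷ Δ) Γ)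
  ρ⁻-step : ∀ {Δ Γ i p} → nth Δ i ≡ just p →
            RootStep ρ⁻ (node Δ Γ) (node (del Δ i) Γ)
  σ-step  : ∀ {Δ Γ i j x y} → i ≢ j → nth Γ i ≡ just x → nth Γ j ≡ just y →
            RootStep σ (node Δ Γ) (node Δ (set (set Γ i y) j x))
  π⁺-step : ∀ {Δ Γ i x} → nth Γ i ≡ just x →
            RootStep π⁺ (node Δ Γ) (node Δ (x ∷ Γ))
  π⁻-step : ∀ {Δ Γ i x} → nth Γ i ≡ just x →
            RootStep π⁻ (node Δ Γ) (node Δ (del Γ i))
  𝔯4-step : ∀ {Δ Γ i j β Δ̃ Γ̃ S} →
            nth Γ i ≡ just (β , node Δ̃ Γ̃) → nth Γ̃ j ≡ just (β , S) →
            RootStep 𝔯4 (node Δ Γ) (node Δ (set Γ i (β , S)))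
  λ-step  : ∀ {Δ Γ i α β S} → nth Γ i ≡ just (α , S) → β < α →
            RootStep λ' (node Δ Γ) (node Δ (set Γ i (β , S)))
  J-step  : ∀ {Δ Γ i j α β Δ̃ Γ̃ S} → i ≢ j →
            nth Γ i ≡ just (α , node Δ̃ Γ̃) → nth Γ j ≡ just (β , S) → β < α →
            RootStep J (node Δ Γ)
              (node Δ (del (set Γ i (α , node Δ̃ (Γ̃ ++ ((β , S) ∷ [])))) j))

-- T ↪^μ U : rule μ applied at some position k ∈ Pos(T), i.e.
-- T ↪ T[U']_k where T|_k ↪ U' at the root.
data Step (μ : Rule) : MTree → MTree → Set where
  here  : ∀ {T U} → RootStep μ T U → Step μ T U
  there : ∀ {Δ Γ i α S S'} → nth Γ i ≡ just (α , S) → Step μ S S' →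
          Step μ (node Δ Γ) (node Δ (set Γ i (α , S')))

_↪_ : MTree → MTree → Set
T ↪ U = ∃[ μ ] Step μ T U

_↪*_ : MTree → MTree → Set
_↪*_ = Star _↪_

data Seq : List Rule → MTree → MTree → Set where
  done : ∀ {T} → Seq [] T T
  step : ∀ {μ Ω T U S} → Step μ T U → Seq Ω U S → Seq (μ ∷ Ω) T S

data Atomic : Rule → Set where
  ρ⁺ : Atomic ρ⁺
  ρ⁻ : Atomic ρ⁻

data Structural : Rule → Set where
  σ : Structural σ

data Replicative : Rule → Set where
  π⁺ : Replicative π⁺

data Decreasing : Rule → Set where
  π⁻ : Decreasing π⁻
  𝔯4 : Decreasing 𝔯4

data Modal : Rule → Set where
  λ' : Modal λ'
  J  : Modal J

Normal : List Rule → Set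
Normal Ω = Σ (List Rule) λ Ωπ → Σ (List Rule) λ Ωm → Σ (List Rule) λ Ωδ →
           Σ (List Rule) λ Ωρ → Σ (List Rule) λ Ωσ →
           All Replicative Ωπ × All Modal Ωm × All Decreasing Ωδ ×
           All Atomic Ωρ × All Structural Ωσ ×
           (Ω ≡ Ωπ ++ Ωm ++ Ωδ ++ Ωρ ++ Ωσ)

{-# OPTIONS --safe #-}
module Submission where

-- Each kind of rule is captured by a relation on trees that rules of that kind realise:
-- replication _⊑_ (copies of children are added in front, recursively), modal steps,
-- decreasing _⊳_ (children are deleted, or collapsed by 𝔯4, recursively) and _≽_ for the
-- atomic and structural rules (variables are forgotten and children permuted, recursively).
-- A rewriting sequence is normalised from its end: a rule in front of a normal form
-- ⊑ ⨾ ↪◇* ⨾ ⊳ ⨾ ≽ is pushed to its place. ≽ moves to the right past ⊑, modal steps and ⊳;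
-- ⊳ moves to the right past ⊑ and past modal steps, which it replays along collapsed
-- chains; and replication after a modal step is done before it instead: the children
-- involved in a J step are copied first, and the copies of the moved child are moved by
-- further J steps, at the price of reordering grandchildren, i.e. of a final ≽.

open import Defs
open import Data.Empty using (⊥-elim)
open import Data.List using (List; []; _∷_; _++_; _∷ʳ_; [_]; length; map)
open import Data.List.Properties using (++-assoc; ++-identityʳ; ∷-injective)
open import Data.List.Membership.Propositional using (_∈_; find; lose)
open import Data.List.Membership.Propositional.Properties using (∈-insert; ∈-++⁺ʳ; ∈-∃++)
open import Data.List.Relation.Binary.Permutation.Propositional as ↭ using (_↭_; ↭-refl; ↭-sym; ↭-trans; prep; swap)
import Data.List.Relation.Binary.Permutation.Propositional.Properties as ↭
open import Data.List.Relation.Binary.Pointwise as Pointwise using (Pointwise; []; _∷_)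
open import Data.List.Relation.Binary.Subset.Propositional using (_⊆_)
import Data.List.Relation.Binary.Subset.Propositional.Properties as ⊆
open import Data.List.Relation.Unary.All as All using (All; []; _∷_)
import Data.List.Relation.Unary.All.Properties as All
open import Data.List.Relation.Unary.Any as Any using (Any; here; there)
import Data.List.Relation.Unary.Any.Properties as Any
open import Data.Maybe using (just)
open import Data.Nat using (ℕ; zero; suc; _+_; _<_)
open import Data.Nat.Properties using (m≢1+m+n; +-suc; suc-injective)
open import Data.Product using (Σ; ∃; ∃₂; ∃-syntax; _×_; _,_; proj₂)
open import Data.Sum using (_⊎_; inj₁; inj₂; map₂)
open import Function using (_∘_; id)
open import Relation.Binary.Construct.Closure.ReflexiveTransitive using (Star; ε; _◅_; _◅◅_; gmap)
open import Relation.Binary.PropositionalEquality using (_≡_; _≢_; refl; sym; trans; cong; subst)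
open import Relation.Nullary using (¬_)

Child : Set
Child = ℕ × MTree

infixr 9 _⨾_
_⨾_ : (MTree → MTree → Set) → (MTree → MTree → Set) → MTree → MTree → Set
(R ⨾ Q) T V = ∃[ U ] R T U × Q U V

private variable
  A B : Set
  R : A → B → Set
  a α β : ℕ
  p : PropVar
  μ : Rule
  x x′ y : A
  u v w : Child
  Δ Δ′ Δ̃ : List PropVar
  Γ Γ′ Γ̃ Γw Γw′ as bs cs ds xs xs′ ys ys′ zs : List A
  S S′ S₀ T U V X : MTree

data Labelled (R : MTree → MTree → Set) : Child → Child → Set where
  ⟨_⟩ : R S S′ → Labelled R (a , S) (a , S′)

position : List A → ℕ
position as = suc (length as)

nth-position : ∀ (as : List A) x bs → nth (as ++ x ∷ bs) (position as) ≡ just x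
nth-position []           x bs = refl
nth-position (_ ∷ [])     x bs = refl
nth-position (_ ∷ a ∷ as) x bs = nth-position (a ∷ as) x bs

set-position : ∀ (as : List A) x bs y → set (as ++ x ∷ bs) (position as) y ≡ as ++ y ∷ bs
set-position []           x bs y = refl
set-position (_ ∷ [])     x bs y = refl
set-position (a ∷ a′ ∷ as) x bs y = cong (a ∷_) (set-position (a′ ∷ as) x bs y)

del-position : ∀ (as : List A) x bs → del (as ++ x ∷ bs) (position as) ≡ as ++ bs
del-position []            x bs = refl
del-position (_ ∷ [])      x bs = refl
del-position (a ∷ a′ ∷ as) x bs = cong (a ∷_) (del-position (a′ ∷ as) x bs)

position₂ : List A → List A → ℕ
position₂ as bs = suc (length as + position bs)

nth-position₂ : ∀ (as : List A) x bs y cs → nth (as ++ x ∷ bs ++ y ∷ cs) (position₂ as bs) ≡ just y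
nth-position₂ []       x bs y cs = nth-position bs y cs
nth-position₂ (_ ∷ as) x bs y cs = nth-position₂ as x bs y cs

set-position₂ : ∀ (as : List A) x bs y cs z →
                set (as ++ x ∷ bs ++ y ∷ cs) (position₂ as bs) z ≡ as ++ x ∷ bs ++ z ∷ cs
set-position₂ []       x bs y cs z = cong (x ∷_) (set-position bs y cs z)
set-position₂ (a ∷ as) x bs y cs z = cong (a ∷_) (set-position₂ as x bs y cs z)

del-position₂ : ∀ (as : List A) x bs y cs → del (as ++ x ∷ bs ++ y ∷ cs) (position₂ as bs) ≡ as ++ x ∷ bs ++ cs
del-position₂ []       x bs y cs = cong (x ∷_) (del-position bs y cs)
del-position₂ (a ∷ as) x bs y cs = cong (a ∷_) (del-position₂ as x bs y cs)

position≢position₂ : ∀ (as bs : List A) → position as ≢ position₂ as bs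
position≢position₂ as bs eq = m≢1+m+n (length as) (trans (suc-injective eq) (+-suc (length as) (length bs)))

nth-split : ∀ (Γ : List A) i → nth Γ i ≡ just x → ∃₂ λ as bs → Γ ≡ as ++ x ∷ bs × i ≡ position as
nth-split (y ∷ ys) (suc zero)    refl = [] , ys , refl , refl
nth-split (y ∷ ys) (suc (suc i)) e with nth-split ys (suc i) e
... | as , bs , refl , eq = y ∷ as , bs , refl , cong suc eq

data TwoPositions (Γ : List A) (i j : ℕ) (x y : A) : Set where
  ordered  : ∀ as bs cs → Γ ≡ as ++ x ∷ bs ++ y ∷ cs →
             i ≡ position as → j ≡ position₂ as bs → TwoPositions Γ i j x y
  reversed : ∀ as bs cs → Γ ≡ as ++ y ∷ bs ++ x ∷ cs →
             j ≡ position as → i ≡ position₂ as bs → TwoPositions Γ i j x y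

two-positions : ∀ (Γ : List A) i j → i ≢ j → nth Γ i ≡ just x → nth Γ j ≡ just y → TwoPositions Γ i j x y
two-positions (z ∷ zs) (suc zero) (suc zero) i≢j _ _ = ⊥-elim (i≢j refl)
two-positions (z ∷ zs) (suc zero) (suc (suc j)) _ refl e with nth-split zs (suc j) e
... | bs , cs , refl , eq = ordered [] bs cs refl refl (cong suc eq)
two-positions (z ∷ zs) (suc (suc i)) (suc zero) _ e refl with nth-split zs (suc i) e
... | bs , cs , refl , eq = reversed [] bs cs refl refl (cong suc eq)
two-positions (z ∷ zs) (suc (suc i)) (suc (suc j)) i≢j e e′
  with two-positions zs (suc i) (suc j) (i≢j ∘ cong suc) e e′
... | ordered  as bs cs refl refl refl = ordered  (z ∷ as) bs cs refl refl refl
... | reversed as bs cs refl refl refl = reversed (z ∷ as) bs cs refl refl refl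

nth⇒∈ : ∀ (Γ : List A) i → nth Γ i ≡ just x → x ∈ Γ
nth⇒∈ Γ i e with nth-split Γ i e
... | as , bs , refl , _ = ∈-insert as

∈⇒nth : x ∈ Γ → ∃[ i ] nth Γ i ≡ just x
∈⇒nth {Γ = x ∷ _}     (here refl) = 1 , refl
∈⇒nth {Γ = _ ∷ _ ∷ _} (there x∈)  with ∈⇒nth x∈
... | suc i , e = suc (suc i) , e

++≡++-∷ : ∀ (es fs ls ms : List A) → es ++ fs ≡ ls ++ x ∷ ms →
          (∃[ ns ] es ≡ ls ++ x ∷ ns × ms ≡ ns ++ fs) ⊎ (∃[ ns ] fs ≡ ns ++ x ∷ ms × ls ≡ es ++ ns)
++≡++-∷ []       fs ls       ms eq   = inj₂ (ls , eq , refl)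
++≡++-∷ (e ∷ es) fs []       ms refl = inj₁ (es , refl , refl)
++≡++-∷ (e ∷ es) fs (l ∷ ls) ms eq with ∷-injective eq
... | refl , eq′ with ++≡++-∷ es fs ls ms eq′
... | inj₁ (ns , refl , refl) = inj₁ (ns , refl , refl)
... | inj₂ (ns , refl , refl) = inj₂ (ns , refl , refl)

⊆-insert : ∀ (as : List A) bs → as ++ bs ⊆ as ++ x ∷ bs
⊆-insert as bs = ⊆.++⁺ id (⊆.xs⊆x∷xs bs _)

swap-↭ : ∀ (as : List A) x bs y cs → as ++ x ∷ bs ++ y ∷ cs ↭ as ++ y ∷ bs ++ x ∷ cs
swap-↭ as x bs y cs = ↭.++⁺ˡ as (begin
  x ∷ bs ++ y ∷ cs   ↭⟨ prep x (↭.shift y bs cs) ⟩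
  x ∷ y ∷ bs ++ cs   ↭⟨ swap x y ↭-refl ⟩
  y ∷ x ∷ bs ++ cs   ↭⟨ prep y (↭-sym (↭.shift x bs cs)) ⟩
  y ∷ bs ++ x ∷ cs   ∎)
  where open ↭.PermutationReasoning

Pointwise-↭ : Pointwise R xs ys → ys ↭ zs → ∃[ xs′ ] xs ↭ xs′ × Pointwise R xs′ zs
Pointwise-↭ rs ↭.refl = _ , ↭-refl , rs
Pointwise-↭ (r ∷ rs) (prep _ p) with Pointwise-↭ rs p
... | _ , p′ , rs′ = _ , prep _ p′ , r ∷ rs′
Pointwise-↭ (r ∷ r′ ∷ rs) (swap _ _ p) with Pointwise-↭ rs p
... | _ , p′ , rs′ = _ , swap _ _ p′ , r′ ∷ r ∷ rs′
Pointwise-↭ rs (↭.trans p q) with Pointwise-↭ rs p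
... | _ , p′ , rs′ with Pointwise-↭ rs′ q
... | _ , q′ , rs″ = _ , ↭.trans p′ q′ , rs″

↭-Pointwise : xs ↭ ys → Pointwise R ys zs → ∃[ zs′ ] Pointwise R xs zs′ × zs′ ↭ zs
↭-Pointwise ↭.refl rs = _ , rs , ↭-refl
↭-Pointwise (prep _ p) (r ∷ rs) with ↭-Pointwise p rs
... | _ , rs′ , p′ = _ , r ∷ rs′ , prep _ p′
↭-Pointwise (swap _ _ p) (r ∷ r′ ∷ rs) with ↭-Pointwise p rs
... | _ , rs′ , p′ = _ , r′ ∷ r ∷ rs′ , swap _ _ p′
↭-Pointwise (↭.trans p q) rs with ↭-Pointwise q rs
... | _ , rs′ , q′ with ↭-Pointwise p rs′
... | _ , rs″ , p′ = _ , rs″ , ↭.trans p′ q′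

Pointwise-splitˡ : ∀ as → Pointwise R (as ++ bs) zs → ∃₂ λ gs hs → zs ≡ gs ++ hs × Pointwise R as gs × Pointwise R bs hs
Pointwise-splitˡ []       rs       = [] , _ , refl , [] , rs
Pointwise-splitˡ (_ ∷ as) (r ∷ rs) with Pointwise-splitˡ as rs
... | gs , hs , refl , rs₁ , rs₂ = _ ∷ gs , hs , refl , r ∷ rs₁ , rs₂

Pointwise-splitʳ : ∀ as → Pointwise R zs (as ++ bs) → ∃₂ λ gs hs → zs ≡ gs ++ hs × Pointwise R gs as × Pointwise R hs bs
Pointwise-splitʳ []       rs       = [] , _ , refl , [] , rs
Pointwise-splitʳ (_ ∷ as) (r ∷ rs) with Pointwise-splitʳ as rs
... | gs , hs , refl , rs₁ , rs₂ = _ ∷ gs , hs , refl , r ∷ rs₁ , rs₂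

Pointwise-at : ∀ as bs → (∀ {z} → R x′ z → R x z) → Pointwise R (as ++ x′ ∷ bs) zs → Pointwise R (as ++ x ∷ bs) zs
Pointwise-at []       bs f (r ∷ rs) = f r ∷ rs
Pointwise-at (_ ∷ as) bs f (r ∷ rs) = r ∷ Pointwise-at as bs f rs

Any-at : ∀ {P : A → Set} as bs → (P x′ → P x) → Any P (as ++ x′ ∷ bs) → Any P (as ++ x ∷ bs)
Any-at []       bs f (here px)  = here (f px)
Any-at []       bs f (there pb) = there pb
Any-at (_ ∷ as) bs f (here pa)  = here pa
Any-at (_ ∷ as) bs f (there p)  = there (Any-at as bs f p)

Any-middle⁻ : ∀ {P : A → Set} as bs → Any P (as ++ x ∷ bs) → P x ⊎ Any P (as ++ bs)
Any-middle⁻ []       bs (here px)  = inj₁ px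
Any-middle⁻ []       bs (there pb) = inj₂ pb
Any-middle⁻ (_ ∷ as) bs (here pa)  = inj₂ (here pa)
Any-middle⁻ (_ ∷ as) bs (there p)  = map₂ there (Any-middle⁻ as bs p)

All⇒Pointwise : {P : B → Set} {Q : A → Set} → (∀ {y} → P y → ∃[ x ] Q x × R x y) →
                All P ys → ∃[ xs ] All Q xs × Pointwise R xs ys
All⇒Pointwise f []       = [] , [] , []
All⇒Pointwise f (p ∷ ps) with f p | All⇒Pointwise f ps
... | x , q , r | xs , qs , rs = x ∷ xs , q ∷ qs , r ∷ rs

-- Rewriting steps at list positions

infix 4 _⇀[_]_
data _⇀[_]_ : MTree → Rule → MTree → Set where
  ρ⁺     : p ∈ Δ → node Δ Γ ⇀[ ρ⁺ ] node (p ∷ Δ) Γ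
  ρ⁻     : ∀ ds p es → node (ds ++ p ∷ es) Γ ⇀[ ρ⁻ ] node (ds ++ es) Γ
  σ      : ∀ as x bs y cs → node Δ (as ++ x ∷ bs ++ y ∷ cs) ⇀[ σ ] node Δ (as ++ y ∷ bs ++ x ∷ cs)
  π⁺     : x ∈ Γ → node Δ Γ ⇀[ π⁺ ] node Δ (x ∷ Γ)
  π⁻     : ∀ as x bs → node Δ (as ++ x ∷ bs) ⇀[ π⁻ ] node Δ (as ++ bs)
  𝔯4     : ∀ as bs cs ds →
           node Δ (as ++ (β , node Δ̃ (cs ++ (β , S) ∷ ds)) ∷ bs) ⇀[ 𝔯4 ] node Δ (as ++ (β , S) ∷ bs)
  λ'     : ∀ as bs → β < α → node Δ (as ++ (α , S) ∷ bs) ⇀[ λ' ] node Δ (as ++ (β , S) ∷ bs)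
  J→     : ∀ as bs cs → β < α →
           node Δ (as ++ (α , node Δ̃ Γ̃) ∷ bs ++ (β , S) ∷ cs) ⇀[ J ]
           node Δ (as ++ (α , node Δ̃ (Γ̃ ∷ʳ (β , S))) ∷ bs ++ cs)
  J←     : ∀ as bs cs → β < α →
           node Δ (as ++ (β , S) ∷ bs ++ (α , node Δ̃ Γ̃) ∷ cs) ⇀[ J ]
           node Δ (as ++ bs ++ (α , node Δ̃ (Γ̃ ∷ʳ (β , S))) ∷ cs)
  inside : ∀ as a bs → T ⇀[ μ ] U → node Δ (as ++ (a , T) ∷ bs) ⇀[ μ ] node Δ (as ++ (a , U) ∷ bs)

RootStep⇒⇀ : RootStep μ T U → T ⇀[ μ ] U
RootStep⇒⇀ (ρ⁺-step {Δ} {i = i} e) = ρ⁺ (nth⇒∈ Δ i e)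
RootStep⇒⇀ (ρ⁻-step {Δ} {i = i} {p} e) with nth-split Δ i e
... | ds , es , refl , refl rewrite del-position ds p es = ρ⁻ ds p es
RootStep⇒⇀ (σ-step {Γ = Γ} {i} {j} {x} {y} i≢j e e′) with two-positions Γ i j i≢j e e′
... | ordered as bs cs refl refl refl
  rewrite set-position as x (bs ++ y ∷ cs) y | set-position₂ as y bs y cs x = σ as x bs y cs
... | reversed as bs cs refl refl refl
  rewrite set-position₂ as y bs x cs y | set-position as y (bs ++ y ∷ cs) x = σ as y bs x cs
RootStep⇒⇀ (π⁺-step {Γ = Γ} {i} e) = π⁺ (nth⇒∈ Γ i e)
RootStep⇒⇀ (π⁻-step {Γ = Γ} {i} {x} e) with nth-split Γ i e
... | as , bs , refl , refl rewrite del-position as x bs = π⁻ as x bs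
RootStep⇒⇀ (𝔯4-step {Γ = Γ} {i} {j} {β} {Δ̃} {Γ̃} {S} e e′) with nth-split Γ i e | nth-split Γ̃ j e′
... | as , bs , refl , refl | cs , ds , refl , refl
  rewrite set-position as (β , node Δ̃ (cs ++ (β , S) ∷ ds)) bs (β , S) = 𝔯4 as bs cs ds
RootStep⇒⇀ (λ-step {Γ = Γ} {i} {α} {β} {S} e β<α) with nth-split Γ i e
... | as , bs , refl , refl rewrite set-position as (α , S) bs (β , S) = λ' as bs β<α
RootStep⇒⇀ (J-step {Γ = Γ} {i} {j} {α} {β} {Δ̃} {Γ̃} {S} i≢j e e′ β<α) with two-positions Γ i j i≢j e e′
... | ordered as bs cs refl refl refl
  rewrite set-position as (α , node Δ̃ Γ̃) (bs ++ (β , S) ∷ cs) (α , node Δ̃ (Γ̃ ∷ʳ (β , S)))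
        | del-position₂ as (α , node Δ̃ (Γ̃ ∷ʳ (β , S))) bs (β , S) cs = J→ as bs cs β<α
... | reversed as bs cs refl refl refl
  rewrite set-position₂ as (β , S) bs (α , node Δ̃ Γ̃) cs (α , node Δ̃ (Γ̃ ∷ʳ (β , S)))
        | del-position as (β , S) (bs ++ (α , node Δ̃ (Γ̃ ∷ʳ (β , S))) ∷ cs) = J← as bs cs β<α

Step⇒⇀ : Step μ T U → T ⇀[ μ ] U
Step⇒⇀ (here s) = RootStep⇒⇀ s
Step⇒⇀ (there {Γ = Γ} {i} {α} {S} {S′} e s) with nth-split Γ i e
... | as , bs , refl , refl rewrite set-position as (α , S) bs (α , S′) = inside as α bs (Step⇒⇀ s)

cast-children : (R : MTree → MTree → Set) → Γ ≡ Γ′ → xs ≡ xs′ → R (node Δ Γ) (node Δ′ xs) → R (node Δ Γ′) (node Δ′ xs′)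
cast-children R refl refl r = r

⇀⇒Step : T ⇀[ μ ] U → Step μ T U
⇀⇒Step (ρ⁺ p∈Δ) = here (ρ⁺-step (proj₂ (∈⇒nth p∈Δ)))
⇀⇒Step (ρ⁻ ds p es) =
  subst (λ Δ → Step ρ⁻ (node (ds ++ p ∷ es) _) (node Δ _)) (del-position ds p es) (here (ρ⁻-step (nth-position ds p es)))
⇀⇒Step (σ as x bs y cs) = cast-children (Step _) refl swapped
  (here (σ-step (position≢position₂ as bs) (nth-position as x _) (nth-position₂ as x bs y cs)))
  where
  swapped : set (set (as ++ x ∷ bs ++ y ∷ cs) (position as) y) (position₂ as bs) x
            ≡ as ++ y ∷ bs ++ x ∷ cs
  swapped rewrite set-position as x (bs ++ y ∷ cs) y = set-position₂ as y bs y cs x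
⇀⇒Step (π⁺ x∈Γ) = here (π⁺-step (proj₂ (∈⇒nth x∈Γ)))
⇀⇒Step (π⁻ as x bs) = cast-children (Step _) refl (del-position as x bs) (here (π⁻-step (nth-position as x bs)))
⇀⇒Step (𝔯4 as bs cs ds) = cast-children (Step _) refl (set-position as _ bs _)
  (here (𝔯4-step (nth-position as _ bs) (nth-position cs _ ds)))
⇀⇒Step (λ' as bs β<α) = cast-children (Step _) refl (set-position as _ bs _)
  (here (λ-step (nth-position as _ bs) β<α))
⇀⇒Step (J→ {β = β} {α = α} {Δ̃ = Δ̃} {Γ̃ = Γ̃} {S = S} as bs cs β<α) = cast-children (Step _) refl moved
  (here (J-step {Γ = as ++ N ∷ bs ++ (β , S) ∷ cs} (position≢position₂ as bs) (nth-position as N _) (nth-position₂ as N bs (β , S) cs) β<α))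
  where
  N N⁺ : Child
  N = (α , node Δ̃ Γ̃)
  N⁺ = (α , node Δ̃ (Γ̃ ∷ʳ (β , S)))
  moved : del (set (as ++ N ∷ bs ++ (β , S) ∷ cs) (position as) N⁺) (position₂ as bs) ≡ as ++ N⁺ ∷ bs ++ cs
  moved rewrite set-position as N (bs ++ (β , S) ∷ cs) N⁺ = del-position₂ as N⁺ bs (β , S) cs
⇀⇒Step (J← {β = β} {α = α} {S = S} {Δ̃ = Δ̃} {Γ̃ = Γ̃} as bs cs β<α) = cast-children (Step _) refl moved
  (here (J-step {Γ = as ++ (β , S) ∷ bs ++ N ∷ cs} (position≢position₂ as bs ∘ sym) (nth-position₂ as (β , S) bs N cs) (nth-position as (β , S) _) β<α))
  where
  N N⁺ : Child
  N = (α , node Δ̃ Γ̃)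
  N⁺ = (α , node Δ̃ (Γ̃ ∷ʳ (β , S)))
  moved : del (set (as ++ (β , S) ∷ bs ++ N ∷ cs) (position₂ as bs) N⁺) (position as) ≡ as ++ bs ++ N⁺ ∷ cs
  moved rewrite set-position₂ as (β , S) bs N cs N⁺ = del-position as (β , S) (bs ++ N⁺ ∷ cs)
⇀⇒Step (inside as a bs s) = cast-children (Step _) refl (set-position as _ bs _)
  (there (nth-position as _ bs) (⇀⇒Step s))

infix 4 _↪⟨_⟩_ _↪⟨_⟩*_
_↪⟨_⟩_ : MTree → (Rule → Set) → MTree → Set
T ↪⟨ K ⟩ U = ∃[ μ ] K μ × T ⇀[ μ ] U

_↪⟨_⟩*_ : MTree → (Rule → Set) → MTree → Set
T ↪⟨ K ⟩* U = Star (λ T U → T ↪⟨ K ⟩ U) T U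

private variable
  K : Rule → Set

step* : K μ → T ⇀[ μ ] U → T ↪⟨ K ⟩* U
step* k s = (_ , k , s) ◅ ε

↪*⇒Seq : T ↪⟨ K ⟩* U → ∃[ Ω ] All K Ω × Seq Ω T U
↪*⇒Seq ε = [] , [] , done
↪*⇒Seq ((μ , k , s) ◅ ss) with ↪*⇒Seq ss
... | Ω , ks , seq = μ ∷ Ω , k ∷ ks , step (⇀⇒Step s) seq

Seq-++ : ∀ {Ω Ω′} → Seq Ω T U → Seq Ω′ U V → Seq (Ω ++ Ω′) T V
Seq-++ done        s′ = s′
Seq-++ (step s ss) s′ = step s (Seq-++ ss s′)

inside* : ∀ as a bs → S ↪⟨ K ⟩* S′ → node Δ (as ++ (a , S) ∷ bs) ↪⟨ K ⟩* node Δ (as ++ (a , S′) ∷ bs)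
inside* as a bs = gmap _ (λ (μ , k , s) → μ , k , inside as a bs s)

children* : ∀ pre → Pointwise (Labelled (_↪⟨ K ⟩*_)) Γ Γ′ → node Δ (pre ++ Γ) ↪⟨ K ⟩* node Δ (pre ++ Γ′)
children* pre [] = ε
children* {K = K} pre (⟨ s ⟩ ∷ ss) = inside* pre _ _ s ◅◅
  cast-children _↪⟨ K ⟩*_ (++-assoc pre _ _) (++-assoc pre _ _) (children* (pre ++ [ _ ]) ss)

_◂_ : Child → MTree → MTree
x ◂ node Δ Γ = node Δ (x ∷ Γ)

◂-⇀ : ¬ Replicative μ → T ⇀[ μ ] U → x ◂ T ⇀[ μ ] x ◂ U
◂-⇀ _  (ρ⁺ p∈Δ)            = ρ⁺ p∈Δ
◂-⇀ _  (ρ⁻ ds p es)        = ρ⁻ ds p es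
◂-⇀ _  (σ as x bs y cs)    = σ (_ ∷ as) x bs y cs
◂-⇀ ¬π (π⁺ _)              = ⊥-elim (¬π π⁺)
◂-⇀ _  (π⁻ as x bs)        = π⁻ (_ ∷ as) x bs
◂-⇀ _  (𝔯4 as bs cs ds)    = 𝔯4 (_ ∷ as) bs cs ds
◂-⇀ _  (λ' as bs β<α)      = λ' (_ ∷ as) bs β<α
◂-⇀ _  (J→ as bs cs β<α)   = J→ (_ ∷ as) bs cs β<α
◂-⇀ _  (J← as bs cs β<α)   = J← (_ ∷ as) bs cs β<α
◂-⇀ _  (inside as a bs s)  = inside (_ ∷ as) a bs s

◂-↪* : (∀ {μ} → K μ → ¬ Replicative μ) → T ↪⟨ K ⟩* U → x ◂ T ↪⟨ K ⟩* x ◂ U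
◂-↪* ¬π = gmap _ (λ (μ , k , s) → μ , k , ◂-⇀ (¬π k) s)

-- Atomic and structural rules

infix 4 _≽_ _≽ᶜ_
data _≽_ : MTree → MTree → Set where
  node : ∀ {Δ Δ′ Γ Γ₁ Γ′} → Δ′ ⊆ Δ → Γ ↭ Γ₁ → Pointwise (Labelled _≽_) Γ₁ Γ′ → node Δ Γ ≽ node Δ′ Γ′

_≽ᶜ_ : List Child → List Child → Set
_≽ᶜ_ = Pointwise (Labelled _≽_)

mutual
  ≽-refl : ∀ T → T ≽ T
  ≽-refl (node Δ Γ) = node id ↭-refl (≽ᶜ-refl Γ)

  ≽ᶜ-refl : ∀ Γ → Γ ≽ᶜ Γ
  ≽ᶜ-refl []            = []
  ≽ᶜ-refl ((a , S) ∷ Γ) = ⟨ ≽-refl S ⟩ ∷ ≽ᶜ-refl Γ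

mutual
  ≽-trans : T ≽ U → U ≽ V → T ≽ V
  ≽-trans (node Δ⊆ p rs) (node Δ⊆′ p′ rs′) with Pointwise-↭ rs p′
  ... | _ , p″ , rs″ = node (Δ⊆ ∘ Δ⊆′) (↭-trans p p″) (≽ᶜ-trans rs″ rs′)

  ≽ᶜ-trans : xs ≽ᶜ ys → ys ≽ᶜ zs → xs ≽ᶜ zs
  ≽ᶜ-trans []           []             = []
  ≽ᶜ-trans (⟨ r ⟩ ∷ rs) (⟨ r′ ⟩ ∷ rs′) = ⟨ ≽-trans r r′ ⟩ ∷ ≽ᶜ-trans rs rs′

≽ᶜ-at : ∀ as a bs → S ≽ S′ → as ++ (a , S) ∷ bs ≽ᶜ as ++ (a , S′) ∷ bs
≽ᶜ-at as a bs r = Pointwise.++⁺ (≽ᶜ-refl as) (⟨ r ⟩ ∷ ≽ᶜ-refl bs)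

⇀⇒≽ : Atomic μ ⊎ Structural μ → T ⇀[ μ ] U → T ≽ U
⇀⇒≽ (inj₁ ρ⁺) (ρ⁺ p∈Δ) = node (λ { (here refl) → p∈Δ ; (there q) → q }) ↭-refl (≽ᶜ-refl _)
⇀⇒≽ (inj₁ ρ⁻) (ρ⁻ ds p es) = node (⊆-insert ds es) ↭-refl (≽ᶜ-refl _)
⇀⇒≽ (inj₂ σ) (σ as x bs y cs) = node id (swap-↭ as x bs y cs) (≽ᶜ-refl _)
⇀⇒≽ k (inside as a bs s) = node id ↭-refl (≽ᶜ-at as a bs (⇀⇒≽ k s))

⊆⇒ρ* : Δ′ ⊆ Δ → node Δ Γ ↪⟨ Atomic ⟩* node Δ′ Γ
⊆⇒ρ* {Δ′} {Δ} {Γ} Δ′⊆Δ = prepend Δ′ Δ′⊆Δ ◅◅ forget Δ′ _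
  where
  prepend : ∀ ds → ds ⊆ Δ → node Δ Γ ↪⟨ Atomic ⟩* node (ds ++ Δ) Γ
  prepend []       _  = ε
  prepend (d ∷ ds) ⊆Δ = prepend ds (⊆Δ ∘ there) ◅◅ step* ρ⁺ (ρ⁺ (∈-++⁺ʳ ds (⊆Δ (here refl))))

  forget : ∀ ds es → node (ds ++ es) Γ ↪⟨ Atomic ⟩* node ds Γ
  forget ds []       = subst (λ D → node D Γ ↪⟨ Atomic ⟩* node ds Γ) (sym (++-identityʳ ds)) ε
  forget ds (e ∷ es) = step* ρ⁻ (ρ⁻ ds e es) ◅◅ forget ds es

structural⇒¬replicative : Structural μ → ¬ Replicative μ
structural⇒¬replicative σ ()

↭⇒σ* : Γ ↭ Γ′ → node Δ Γ ↪⟨ Structural ⟩* node Δ Γ′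
↭⇒σ* ↭.refl         = ε
↭⇒σ* (prep x p)     = ◂-↪* structural⇒¬replicative (↭⇒σ* p)
↭⇒σ* (swap x y p)   = step* σ (σ [] x [] y _) ◅◅ ◂-↪* structural⇒¬replicative (◂-↪* structural⇒¬replicative (↭⇒σ* p))
↭⇒σ* (↭.trans p q)  = ↭⇒σ* p ◅◅ ↭⇒σ* q

mutual
  ≽⇒ρ*σ* : T ≽ U → (_↪⟨ Atomic ⟩*_ ⨾ _↪⟨ Structural ⟩*_) T U
  ≽⇒ρ*σ* (node {Δ′ = Δ′} Δ′⊆Δ p rs) with ↭-Pointwise p rs
  ... | _ , rs′ , p′ with ≽ᶜ⇒ρ*σ* rs′
  ... | Ms , ρs , σs = node Δ′ Ms , ⊆⇒ρ* Δ′⊆Δ ◅◅ children* [] ρs , children* [] σs ◅◅ ↭⇒σ* p′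

  ≽ᶜ⇒ρ*σ* : Γ ≽ᶜ Γ′ → ∃[ Ms ] Pointwise (Labelled _↪⟨ Atomic ⟩*_) Γ Ms × Pointwise (Labelled _↪⟨ Structural ⟩*_) Ms Γ′
  ≽ᶜ⇒ρ*σ* []           = [] , [] , []
  ≽ᶜ⇒ρ*σ* (⟨ r ⟩ ∷ rs) with ≽⇒ρ*σ* r | ≽ᶜ⇒ρ*σ* rs
  ... | _ , ρs , σs | _ , ρss , σss = _ , ⟨ ρs ⟩ ∷ ρss , ⟨ σs ⟩ ∷ σss

infix 4 _≽ˡ_
_≽ˡ_ : List Child → List Child → Set
Γ ≽ˡ Γ′ = ∃[ Γ₁ ] Γ ↭ Γ₁ × Γ₁ ≽ᶜ Γ′

≽ˡ-find : ∀ cs ds → Γ ≽ˡ cs ++ (a , S) ∷ ds →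
          ∃[ es ] ∃[ S₀ ] ∃[ fs ] Γ ≡ es ++ (a , S₀) ∷ fs × S₀ ≽ S × es ++ fs ≽ˡ cs ++ ds
≽ˡ-find cs ds (_ , p , rs) with Pointwise-splitʳ cs rs
... | gs , _ , refl , rs₁ , ⟨ r ⟩ ∷ rs₂ with ∈-∃++ (↭.∈-resp-↭ (↭-sym p) (∈-insert gs))
... | es , fs , refl = es , _ , fs , refl , r , _ , ↭.drop-mid es gs p , Pointwise.++⁺ rs₁ rs₂

≽ˡ-insert : ∀ es fs → es ++ fs ≽ˡ cs ++ ds → S₀ ≽ S → es ++ (a , S₀) ∷ fs ≽ˡ cs ++ (a , S) ∷ ds
≽ˡ-insert {cs = cs} es fs (_ , p , rs) r with Pointwise-splitʳ cs rs
... | gs , hs , refl , rs₁ , rs₂ =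
  _ , ↭-trans (↭.shift _ es fs) (↭-trans (prep _ p) (↭-sym (↭.shift _ gs hs))) , Pointwise.++⁺ rs₁ (⟨ r ⟩ ∷ rs₂)

≽ˡ⇒≽ : Δ′ ⊆ Δ → Γ ≽ˡ Γ′ → node Δ Γ ≽ node Δ′ Γ′
≽ˡ⇒≽ Δ′⊆Δ (_ , p , rs) = node Δ′⊆Δ p rs

-- Decreasing rules

infix 4 _⊳_ _⊳ᶜ_ _⊳ˡ_
mutual
  data _⊳_ : MTree → MTree → Set where
    node : Γ ⊳ˡ Γ′ → node Δ Γ ⊳ node Δ Γ′

  data _⊳ᶜ_ : Child → Child → Set where
    shrink   : T ⊳ U → (a , T) ⊳ᶜ (a , U)
    collapse : ∀ cs ds → (a , S) ⊳ᶜ v → (a , node Δ̃ (cs ++ (a , S) ∷ ds)) ⊳ᶜ v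

  data _⊳ˡ_ : List Child → List Child → Set where
    []   : [] ⊳ˡ []
    drop : Γ ⊳ˡ Γ′ → u ∷ Γ ⊳ˡ Γ′
    keep : u ⊳ᶜ v → Γ ⊳ˡ Γ′ → u ∷ Γ ⊳ˡ v ∷ Γ′

mutual
  ⊳-refl : ∀ T → T ⊳ T
  ⊳-refl (node Δ Γ) = node (⊳ˡ-refl Γ)

  ⊳ˡ-refl : ∀ Γ → Γ ⊳ˡ Γ
  ⊳ˡ-refl []            = []
  ⊳ˡ-refl ((a , S) ∷ Γ) = keep (shrink (⊳-refl S)) (⊳ˡ-refl Γ)

⊳ˡ-++ : xs ⊳ˡ ys → xs′ ⊳ˡ ys′ → xs ++ xs′ ⊳ˡ ys ++ ys′
⊳ˡ-++ []         s′ = s′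
⊳ˡ-++ (drop s)   s′ = drop (⊳ˡ-++ s s′)
⊳ˡ-++ (keep c s) s′ = keep c (⊳ˡ-++ s s′)

⊳ˡ-at : ∀ as bs → u ⊳ᶜ v → as ++ u ∷ bs ⊳ˡ as ++ v ∷ bs
⊳ˡ-at as bs c = ⊳ˡ-++ (⊳ˡ-refl as) (keep c (⊳ˡ-refl bs))

⊳ᶜ-label : (a , S) ⊳ᶜ (α , S′) → a ≡ α
⊳ᶜ-label (shrink _)         = refl
⊳ᶜ-label (collapse _ _ c)   = ⊳ᶜ-label c

⊳ˡ-split : ∀ cs ds → Γ ⊳ˡ cs ++ v ∷ ds →
           ∃[ es ] ∃[ u ] ∃[ fs ] Γ ≡ es ++ u ∷ fs × es ⊳ˡ cs × u ⊳ᶜ v × fs ⊳ˡ ds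
⊳ˡ-split []        ds (drop s) with ⊳ˡ-split [] ds s
... | es , u , fs , refl , s₁ , c , s₂ = _ ∷ es , u , fs , refl , drop s₁ , c , s₂
⊳ˡ-split []        ds (keep c s) = [] , _ , _ , refl , [] , c , s
⊳ˡ-split (c₀ ∷ cs) ds (drop s) with ⊳ˡ-split (c₀ ∷ cs) ds s
... | es , u , fs , refl , s₁ , c , s₂ = _ ∷ es , u , fs , refl , drop s₁ , c , s₂
⊳ˡ-split (_ ∷ cs)  ds (keep c′ s) with ⊳ˡ-split cs ds s
... | es , u , fs , refl , s₁ , c , s₂ = _ ∷ es , u , fs , refl , keep c′ s₁ , c , s₂

mutual
  ⊳-trans : T ⊳ U → U ⊳ V → T ⊳ V
  ⊳-trans (node s) (node s′) = node (⊳ˡ-trans s s′)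

  ⊳ˡ-trans : xs ⊳ˡ ys → ys ⊳ˡ zs → xs ⊳ˡ zs
  ⊳ˡ-trans []         []           = []
  ⊳ˡ-trans (drop s)   s′           = drop (⊳ˡ-trans s s′)
  ⊳ˡ-trans (keep c s) (drop s′)    = drop (⊳ˡ-trans s s′)
  ⊳ˡ-trans (keep c s) (keep c′ s′) = keep (⊳ᶜ-trans c c′) (⊳ˡ-trans s s′)

  ⊳ᶜ-trans : u ⊳ᶜ v → v ⊳ᶜ w → u ⊳ᶜ w
  ⊳ᶜ-trans (collapse cs ds c) c′ = collapse cs ds (⊳ᶜ-trans c c′)
  ⊳ᶜ-trans (shrink n) (shrink n′) = shrink (⊳-trans n n′)
  ⊳ᶜ-trans (shrink (node s)) (collapse cs ds c′) with ⊳ˡ-split cs ds s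
  ... | es , _ , fs , refl , _ , c , _ with ⊳ᶜ-label c
  ... | refl = collapse es fs (⊳ᶜ-trans c c′)

⇀⇒⊳ : Decreasing μ → T ⇀[ μ ] U → T ⊳ U
⇀⇒⊳ π⁻ (π⁻ as x bs)       = node (⊳ˡ-++ (⊳ˡ-refl as) (drop (⊳ˡ-refl bs)))
⇀⇒⊳ 𝔯4 (𝔯4 as bs cs ds)   = node (⊳ˡ-at as bs (collapse cs ds (shrink (⊳-refl _))))
⇀⇒⊳ k  (inside as a bs s) = node (⊳ˡ-at as bs (shrink (⇀⇒⊳ k s)))

decreasing⇒¬replicative : Decreasing μ → ¬ Replicative μ
decreasing⇒¬replicative π⁻ ()
decreasing⇒¬replicative 𝔯4 ()

mutual
  ⊳⇒↪* : T ⊳ U → T ↪⟨ Decreasing ⟩* U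
  ⊳⇒↪* (node s) = ⊳ˡ⇒↪* s

  ⊳ˡ⇒↪* : Γ ⊳ˡ Γ′ → node Δ Γ ↪⟨ Decreasing ⟩* node Δ Γ′
  ⊳ˡ⇒↪* []         = ε
  ⊳ˡ⇒↪* (drop s)   = step* π⁻ (π⁻ [] _ _) ◅◅ ⊳ˡ⇒↪* s
  ⊳ˡ⇒↪* (keep c s) = ⊳ᶜ⇒↪* c ◅◅ ◂-↪* decreasing⇒¬replicative (⊳ˡ⇒↪* s)

  ⊳ᶜ⇒↪* : u ⊳ᶜ v → node Δ (u ∷ Γ) ↪⟨ Decreasing ⟩* node Δ (v ∷ Γ)
  ⊳ᶜ⇒↪* (shrink n)         = inside* [] _ _ (⊳⇒↪* n)
  ⊳ᶜ⇒↪* (collapse cs ds c) = step* 𝔯4 (𝔯4 [] _ cs ds) ◅◅ ⊳ᶜ⇒↪* c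

-- Replicative rules

infix 4 _⊑_ _⊑ᶜ_
mutual
  data _⊑_ : MTree → MTree → Set where
    node : All (CopyOf Γ) ys → Pointwise (Labelled _⊑_) Γ Γ′ → node Δ Γ ⊑ node Δ (ys ++ Γ′)

  CopyOf : List Child → Child → Set
  CopyOf Γ v = Any (λ u → Labelled _⊑_ u v) Γ

_⊑ᶜ_ : List Child → List Child → Set
_⊑ᶜ_ = Pointwise (Labelled _⊑_)

mutual
  ⊑-refl : ∀ T → T ⊑ T
  ⊑-refl (node Δ Γ) = node [] (⊑ᶜ-refl Γ)

  ⊑ᶜ-refl : ∀ Γ → Γ ⊑ᶜ Γ
  ⊑ᶜ-refl []            = []
  ⊑ᶜ-refl ((a , S) ∷ Γ) = ⟨ ⊑-refl S ⟩ ∷ ⊑ᶜ-refl Γ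

∈⇒CopyOf : (a , S) ∈ Γ → S ⊑ S′ → CopyOf Γ (a , S′)
∈⇒CopyOf a∈Γ r = lose a∈Γ ⟨ r ⟩

CopyOf-⊆ : Γ ⊆ Γ′ → CopyOf Γ v → CopyOf Γ′ v
CopyOf-⊆ Γ⊆Γ′ o with find o
... | _ , u∈Γ , r = lose (Γ⊆Γ′ u∈Γ) r

CopyOf-↭ : xs ↭ ys → CopyOf ys v → CopyOf xs v
CopyOf-↭ p = ↭.Any-resp-↭ (↭-sym p)

π⁺-⊑ : T ⇀[ π⁺ ] U → U ⊑ V → T ⊑ V
π⁺-⊑ (π⁺ {u} {Γ} u∈Γ) (node {ys = ys} copies (⟨ r ⟩ ∷ rs)) =
  cast-children _⊑_ refl (++-assoc ys _ _)
    (node (All.++⁺ (All.map (CopyOf-⊆ u∷Γ⊆Γ) copies) (∈⇒CopyOf u∈Γ r ∷ [])) rs)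
  where
  u∷Γ⊆Γ : u ∷ Γ ⊆ Γ
  u∷Γ⊆Γ (here refl) = u∈Γ
  u∷Γ⊆Γ (there v∈Γ) = v∈Γ
π⁺-⊑ (inside as a bs s) (node copies rs) =
  node (All.map (Any-at as bs earlier) copies) (Pointwise-at as bs earlier rs)
  where
  earlier : Labelled _⊑_ (a , _) v → Labelled _⊑_ (a , _) v
  earlier ⟨ r ⟩ = ⟨ π⁺-⊑ s r ⟩

mutual
  ⊑⇒↪* : T ⊑ U → T ↪⟨ Replicative ⟩* U
  ⊑⇒↪* (node copies rs) with copies⇒π⁺* copies
  ... | _ , πs , qs = πs ◅◅ children* [] (Pointwise.++⁺ qs (⊑ᶜ⇒↪* rs))

  ⊑ᶜ⇒↪* : Γ ⊑ᶜ Γ′ → Pointwise (Labelled _↪⟨ Replicative ⟩*_) Γ Γ′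
  ⊑ᶜ⇒↪* []           = []
  ⊑ᶜ⇒↪* (⟨ r ⟩ ∷ rs) = ⟨ ⊑⇒↪* r ⟩ ∷ ⊑ᶜ⇒↪* rs

  copies⇒π⁺* : All (CopyOf Γ) ys →
               ∃[ xs ] node Δ Γ ↪⟨ Replicative ⟩* node Δ (xs ++ Γ) × Pointwise (Labelled _↪⟨ Replicative ⟩*_) xs ys
  copies⇒π⁺* []       = [] , ε , []
  copies⇒π⁺* (o ∷ os) with copies⇒π⁺* os | original o
  ... | xs , πs , qs | u , u∈Γ , q = u ∷ xs , πs ◅◅ step* π⁺ (π⁺ (∈-++⁺ʳ xs u∈Γ)) , q ∷ qs

  original : CopyOf Γ v → ∃[ u ] u ∈ Γ × Labelled _↪⟨ Replicative ⟩*_ u v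
  original (here ⟨ r ⟩) = _ , here refl , ⟨ ⊑⇒↪* r ⟩
  original (there o) with original o
  ... | u , u∈Γ , q = u , there u∈Γ , q

-- Moving atomic, structural and decreasing rules to the right

↭-⊳ˡ : xs ↭ ys → ys ⊳ˡ zs → ∃[ xs′ ] xs ⊳ˡ xs′ × xs′ ↭ zs
↭-⊳ˡ ↭.refl s = _ , s , ↭-refl
↭-⊳ˡ (prep _ p) (drop s) with ↭-⊳ˡ p s
... | _ , s′ , p′ = _ , drop s′ , p′
↭-⊳ˡ (prep _ p) (keep c s) with ↭-⊳ˡ p s
... | _ , s′ , p′ = _ , keep c s′ , prep _ p′
↭-⊳ˡ (swap _ _ p) (drop (drop s)) with ↭-⊳ˡ p s
... | _ , s′ , p′ = _ , drop (drop s′) , p′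
↭-⊳ˡ (swap _ _ p) (drop (keep c s)) with ↭-⊳ˡ p s
... | _ , s′ , p′ = _ , keep c (drop s′) , prep _ p′
↭-⊳ˡ (swap _ _ p) (keep c (drop s)) with ↭-⊳ˡ p s
... | _ , s′ , p′ = _ , drop (keep c s′) , prep _ p′
↭-⊳ˡ (swap _ _ p) (keep c (keep c′ s)) with ↭-⊳ˡ p s
... | _ , s′ , p′ = _ , keep c′ (keep c s′) , swap _ _ p′
↭-⊳ˡ (↭.trans p q) s with ↭-⊳ˡ q s
... | _ , s′ , q′ with ↭-⊳ˡ p s′
... | _ , s″ , p′ = _ , s″ , ↭.trans p′ q′

mutual
  ≽⊳⇒⊳≽ : T ≽ U → U ⊳ V → (_⊳_ ⨾ _≽_) T V
  ≽⊳⇒⊳≽ (node Δ⊆ p rs) (node s) with ≽ᶜ⊳ˡ rs s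
  ... | _ , s′ , rs′ with ↭-⊳ˡ p s′
  ... | _ , s″ , p′ = _ , node s″ , node Δ⊆ p′ rs′

  ≽ᶜ⊳ˡ : xs ≽ᶜ ys → ys ⊳ˡ zs → ∃[ ws ] xs ⊳ˡ ws × ws ≽ᶜ zs
  ≽ᶜ⊳ˡ []           []         = [] , [] , []
  ≽ᶜ⊳ˡ (_ ∷ rs)     (drop s)   with ≽ᶜ⊳ˡ rs s
  ... | ws , s′ , rs′ = ws , drop s′ , rs′
  ≽ᶜ⊳ˡ (⟨ r ⟩ ∷ rs) (keep c s) with ≽⊳ᶜ r c | ≽ᶜ⊳ˡ rs s
  ... | _ , c′ , r′ | _ , s′ , rs′ = _ , keep c′ s′ , r′ ∷ rs′

  ≽⊳ᶜ : S ≽ S′ → (a , S′) ⊳ᶜ v → ∃[ w ] (a , S) ⊳ᶜ w × Labelled _≽_ w v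
  ≽⊳ᶜ r (shrink n) with ≽⊳⇒⊳≽ r n
  ... | _ , n′ , r′ = _ , shrink n′ , ⟨ r′ ⟩
  ≽⊳ᶜ (node _ p rs) (collapse cs ds c) with ≽ˡ-find cs ds (_ , p , rs)
  ... | es , _ , fs , refl , r₀ , _ with ≽⊳ᶜ r₀ c
  ... | w , c′ , r′ = w , collapse es fs c′ , r′

mutual
  ≽⊑⇒⊑≽ : T ≽ U → U ⊑ V → (_⊑_ ⨾ _≽_) T V
  ≽⊑⇒⊑≽ (node Δ⊆ p rs) (node copies qs) with ≽ᶜ⊑ᶜ rs qs | All⇒Pointwise (≽ᶜ-copy rs) copies
  ... | _ , qs′ , rs′ | ys′ , copies′ , rs″ with ↭-Pointwise p qs′
  ... | _ , qs″ , p′ = _ , node (All.map (CopyOf-↭ p) copies′) qs″ , node Δ⊆ (↭.++⁺ˡ ys′ p′) (Pointwise.++⁺ rs″ rs′)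

  ≽ᶜ⊑ᶜ : xs ≽ᶜ ys → ys ⊑ᶜ zs → ∃[ ws ] xs ⊑ᶜ ws × ws ≽ᶜ zs
  ≽ᶜ⊑ᶜ []           []           = [] , [] , []
  ≽ᶜ⊑ᶜ (⟨ r ⟩ ∷ rs) (⟨ q ⟩ ∷ qs) with ≽⊑⇒⊑≽ r q | ≽ᶜ⊑ᶜ rs qs
  ... | _ , q′ , r′ | _ , qs′ , rs′ = _ , ⟨ q′ ⟩ ∷ qs′ , ⟨ r′ ⟩ ∷ rs′

  ≽ᶜ-copy : xs ≽ᶜ ys → CopyOf ys v → ∃[ w ] CopyOf xs w × Labelled _≽_ w v
  ≽ᶜ-copy (⟨ r ⟩ ∷ rs) (here ⟨ q ⟩) with ≽⊑⇒⊑≽ r q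
  ... | _ , q′ , r′ = _ , here ⟨ q′ ⟩ , ⟨ r′ ⟩
  ≽ᶜ-copy (_ ∷ rs) (there o) with ≽ᶜ-copy rs o
  ... | w , o′ , r = w , there o′ , r

Pointwise⇒⊳ˡ : Pointwise _⊳ᶜ_ xs ys → xs ⊳ˡ ys
Pointwise⇒⊳ˡ []       = []
Pointwise⇒⊳ˡ (c ∷ cs) = keep c (Pointwise⇒⊳ˡ cs)

mutual
  ⊳⊑⇒⊑⊳ : T ⊳ U → U ⊑ V → (_⊑_ ⨾ _⊳_) T V
  ⊳⊑⇒⊑⊳ (node s) (node copies qs) with ⊳ˡ⊑ᶜ s qs | All⇒Pointwise (⊳ˡ-copy s) copies
  ... | _ , qs′ , s′ | _ , copies′ , cs = _ , node copies′ qs′ , node (⊳ˡ-++ (Pointwise⇒⊳ˡ cs) s′)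

  ⊳ˡ⊑ᶜ : xs ⊳ˡ ys → ys ⊑ᶜ zs → ∃[ ws ] xs ⊑ᶜ ws × ws ⊳ˡ zs
  ⊳ˡ⊑ᶜ []         []       = [] , [] , []
  ⊳ˡ⊑ᶜ (drop {u = (_ , X)} s) qs with ⊳ˡ⊑ᶜ s qs
  ... | _ , qs′ , s′ = _ , ⟨ ⊑-refl X ⟩ ∷ qs′ , drop s′
  ⊳ˡ⊑ᶜ (keep c s) (q ∷ qs) with ⊳ᶜ⊑ c q | ⊳ˡ⊑ᶜ s qs
  ... | _ , q′ , c′ | _ , qs′ , s′ = _ , q′ ∷ qs′ , keep c′ s′

  ⊳ᶜ⊑ : u ⊳ᶜ v → Labelled _⊑_ v w → ∃[ u′ ] Labelled _⊑_ u u′ × u′ ⊳ᶜ w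
  ⊳ᶜ⊑ (shrink n) ⟨ q ⟩ with ⊳⊑⇒⊑⊳ n q
  ... | _ , q′ , n′ = _ , ⟨ q′ ⟩ , shrink n′
  ⊳ᶜ⊑ (collapse cs ds c) q with ⊳ᶜ⊑ c q
  ... | _ , ⟨ q′ ⟩ , c′ = _ , ⟨ node [] (Pointwise.++⁺ (⊑ᶜ-refl cs) (⟨ q′ ⟩ ∷ ⊑ᶜ-refl ds)) ⟩ , collapse cs ds c′

  ⊳ˡ-copy : xs ⊳ˡ ys → CopyOf ys v → ∃[ u ] CopyOf xs u × u ⊳ᶜ v
  ⊳ˡ-copy (drop s) o with ⊳ˡ-copy s o
  ... | u , o′ , c = u , there o′ , c
  ⊳ˡ-copy (keep c s) (here q) with ⊳ᶜ⊑ c q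
  ... | u , q′ , c′ = u , here q′ , c′
  ⊳ˡ-copy (keep c s) (there o) with ⊳ˡ-copy s o
  ... | u , o′ , c′ = u , there o′ , c′

-- Moving atomic, structural and decreasing rules past modal rules

infix 4 _↪◇_ _↪◇*_
_↪◇_ : MTree → MTree → Set
T ↪◇ U = T ↪⟨ Modal ⟩ U

_↪◇*_ : MTree → MTree → Set
T ↪◇* U = T ↪⟨ Modal ⟩* U

modal⇒¬replicative : Modal μ → ¬ Replicative μ
modal⇒¬replicative λ' ()
modal⇒¬replicative J  ()

++ˡ-↪◇* : ∀ pre → node Δ Γ ↪◇* node Δ Γ′ → node Δ (pre ++ Γ) ↪◇* node Δ (pre ++ Γ′)
++ˡ-↪◇* []        steps = steps
++ˡ-↪◇* (_ ∷ pre) steps = ◂-↪* modal⇒¬replicative (++ˡ-↪◇* pre steps)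

J-between : ∀ P Q ls ms → P ++ Q ≡ ls ++ (α , node Δ̃ Γ̃) ∷ ms → β < α →
            node Δ (P ++ (β , S) ∷ Q) ⇀[ J ] node Δ (ls ++ (α , node Δ̃ (Γ̃ ∷ʳ (β , S))) ∷ ms)
J-between P Q ls ms eq β<α with ++≡++-∷ P Q ls ms eq
... | inj₁ (ns , refl , refl) =
  cast-children _⇀[ J ]_ (sym (++-assoc ls (_ ∷ ns) _)) refl (J→ ls ns Q β<α)
... | inj₂ (ns , refl , refl) =
  cast-children _⇀[ J ]_ refl (sym (++-assoc P ns _)) (J← P ns ms β<α)

≽J⇒J≽ : ∀ P Q ls ms → P ++ Q ≡ ls ++ (α , node Δ̃ Γ̃) ∷ ms → β < α → Δ′ ⊆ Δ → Γ ≽ˡ P ++ (β , S) ∷ Q →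
        (_↪◇_ ⨾ _≽_) (node Δ Γ) (node Δ′ (ls ++ (α , node Δ̃ (Γ̃ ∷ʳ (β , S))) ∷ ms))
≽J⇒J≽ P Q ls ms eq β<α Δ′⊆Δ Γ≽ with ≽ˡ-find P Q Γ≽
... | es , _ , fs , refl , r , Γ≽′ with ≽ˡ-find ls ms (subst (_ ≽ˡ_) eq Γ≽′)
... | gs , node _ _ , hs , eq′ , node Δ⊆ p rs , Γ≽″ =
  _ , (J , J , J-between es fs gs hs eq′ β<α) ,
  ≽ˡ⇒≽ Δ′⊆Δ (≽ˡ-insert gs hs Γ≽″ (node Δ⊆ (↭.++⁺ʳ _ p) (Pointwise.++⁺ rs (⟨ r ⟩ ∷ []))))

≽⇀⇒◇≽ : T ≽ U → Modal μ → U ⇀[ μ ] V → (_↪◇_ ⨾ _≽_) T V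
≽⇀⇒◇≽ (node Δ⊆ p rs) λ' (λ' as bs β<α) with ≽ˡ-find as bs (_ , p , rs)
... | es , _ , fs , refl , r , Γ≽ = _ , (_ , λ' , λ' es fs β<α) , ≽ˡ⇒≽ Δ⊆ (≽ˡ-insert es fs Γ≽ r)
≽⇀⇒◇≽ (node Δ⊆ p rs) J (J→ as bs cs β<α) =
  ≽J⇒J≽ (as ++ _ ∷ bs) cs as (bs ++ cs) (++-assoc as _ cs) β<α Δ⊆
      (subst (_ ≽ˡ_) (sym (++-assoc as _ (_ ∷ cs))) (_ , p , rs))
≽⇀⇒◇≽ (node Δ⊆ p rs) J (J← as bs cs β<α) =
  cast-children (_↪◇_ ⨾ _≽_) refl (++-assoc as bs _)
    (≽J⇒J≽ as (bs ++ _ ∷ cs) (as ++ bs) cs (sym (++-assoc as bs _)) β<α Δ⊆ (_ , p , rs))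
≽⇀⇒◇≽ (node Δ⊆ p rs) m (inside as a bs s) with ≽ˡ-find as bs (_ , p , rs)
... | es , _ , fs , refl , r , Γ≽ with ≽⇀⇒◇≽ r m s
... | _ , (μ , m′ , s′) , r′ = _ , (μ , m′ , inside es a fs s′) , ≽ˡ⇒≽ Δ⊆ (≽ˡ-insert es fs Γ≽ r′)

≽◇*⇒◇*≽ : T ≽ U → U ↪◇* V → (_↪◇*_ ⨾ _≽_) T V
≽◇*⇒◇*≽ r ε = _ , ε , r
≽◇*⇒◇*≽ r ((_ , m , s) ◅ steps) with ≽⇀⇒◇≽ r m s
... | _ , m′ , r′ with ≽◇*⇒◇*≽ r′ steps
... | _ , steps′ , r″ = _ , m′ ◅ steps′ , r″

-- 𝔯4 needs equal labels, so λ has to relabel every node of a collapsed chain.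
relabel : ∀ es fs → β < α → (α , X) ⊳ᶜ (α , S) →
          ∃[ X′ ] node Δ (es ++ (α , X) ∷ fs) ↪◇* node Δ (es ++ (β , X′) ∷ fs) × (β , X′) ⊳ᶜ (β , S)
relabel es fs β<α (shrink n) = _ , step* λ' (λ' es fs β<α) , shrink n
relabel es fs β<α (collapse cs ds c) with relabel cs ds β<α c
... | _ , steps , c′ = _ , step* λ' (λ' es fs β<α) ◅◅ inside* es _ fs steps , collapse cs ds c′

-- The moved child travels down a collapsed chain by one J step per level.
J-into-collapse : β < α → (α , node Δ Γ) ⊳ᶜ (α , node Δ̃ Γ̃) → (β , X) ⊳ᶜ (β , S) →
                  ∃[ X′ ] node Δ (Γ ∷ʳ (β , X)) ↪◇* X′ × (α , X′) ⊳ᶜ (α , node Δ̃ (Γ̃ ∷ʳ (β , S)))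
J-into-collapse β<α (shrink (node s)) c = _ , ε , shrink (node (⊳ˡ-++ s (keep c [])))
J-into-collapse β<α (collapse {S = node _ _} cs ds c₁) c with J-into-collapse β<α c₁ c
... | _ , steps , c′ =
  _ , cast-children _↪◇*_ (sym (++-assoc cs _ _)) refl (step* J (J→ cs ds [] β<α)) ◅◅ inside* cs _ (ds ++ []) steps ,
  collapse cs (ds ++ []) c′

mutual
  ⊳⇀⇒◇*⊳ : T ⊳ U → Modal μ → U ⇀[ μ ] V → (_↪◇*_ ⨾ _⊳_) T V
  ⊳⇀⇒◇*⊳ (node s) λ' (λ' as bs β<α) with ⊳ˡ-split as bs s
  ... | es , _ , fs , refl , s₁ , c , s₂ with ⊳ᶜ-label c
  ... | refl with relabel es fs β<α c
  ... | _ , steps , c′ = _ , steps , node (⊳ˡ-++ s₁ (keep c′ s₂))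
  ⊳⇀⇒◇*⊳ (node s) J (J→ as bs cs β<α) with ⊳ˡ-split as _ s
  ... | es , (_ , node _ _) , fs , refl , s₁ , cN , s₂ with ⊳ˡ-split bs cs s₂
  ... | gs , _ , hs , refl , s₃ , cS , s₄ with ⊳ᶜ-label cN | ⊳ᶜ-label cS
  ... | refl | refl with J-into-collapse β<α cN cS
  ... | _ , steps , c′ =
    _ , step* J (J→ es gs hs β<α) ◅◅ inside* es _ (gs ++ hs) steps , node (⊳ˡ-++ s₁ (keep c′ (⊳ˡ-++ s₃ s₄)))
  ⊳⇀⇒◇*⊳ (node s) J (J← as bs cs β<α) with ⊳ˡ-split as _ s
  ... | es , _ , fs , refl , s₁ , cS , s₂ with ⊳ˡ-split bs cs s₂
  ... | gs , (_ , node _ _) , hs , refl , s₃ , cN , s₄ with ⊳ᶜ-label cN | ⊳ᶜ-label cS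
  ... | refl | refl with J-into-collapse β<α cN cS
  ... | _ , steps , c′ =
    _ , step* J (J← es gs hs β<α) ◅◅ cast-children _↪◇*_ (++-assoc es gs _) refl (inside* (es ++ gs) _ hs steps) ,
    node (subst (_ ⊳ˡ_) (++-assoc as bs _) (⊳ˡ-++ (⊳ˡ-++ s₁ s₃) (keep c′ s₄)))
  ⊳⇀⇒◇*⊳ (node s) m (inside as a bs st) with ⊳ˡ-split as bs s
  ... | es , _ , fs , refl , s₁ , c , s₂ with ⊳ᶜ-label c
  ... | refl with ⊳ᶜ⇀ c m st
  ... | _ , steps , c′ = _ , inside* es a fs steps , node (⊳ˡ-++ s₁ (keep c′ s₂))

  ⊳ᶜ⇀ : (a , X) ⊳ᶜ (a , S) → Modal μ → S ⇀[ μ ] S′ → ∃[ X′ ] X ↪◇* X′ × (a , X′) ⊳ᶜ (a , S′)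
  ⊳ᶜ⇀ (shrink n) m st with ⊳⇀⇒◇*⊳ n m st
  ... | _ , steps , n′ = _ , steps , shrink n′
  ⊳ᶜ⇀ (collapse cs ds c) m st with ⊳ᶜ⇀ c m st
  ... | _ , steps , c′ = _ , inside* cs _ ds steps , collapse cs ds c′

⊳◇*⇒◇*⊳ : T ⊳ U → U ↪◇* V → (_↪◇*_ ⨾ _⊳_) T V
⊳◇*⇒◇*⊳ n ε = _ , ε , n
⊳◇*⇒◇*⊳ n ((_ , m , s) ◅ steps) with ⊳⇀⇒◇*⊳ n m s
... | _ , steps₁ , n′ with ⊳◇*⇒◇*⊳ n′ steps
... | _ , steps₂ , n″ = _ , steps₁ ◅◅ steps₂ , n″

-- Moving replicative rules before modal rules

-- Quantifying over the tail makes _⇉◇_ compose along _++_.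
infix 4 _⇉◇_
_⇉◇_ : List Child → List Child → Set
Γ ⇉◇ Γ′ = ∀ {Δ} post → node Δ (Γ ++ post) ↪◇* node Δ (Γ′ ++ post)

-- A copy v made after a modal step can be made before it instead, as a segment of copies of
-- children in Γ that modal steps turn into v, up to ≽.
ModalCopy : List Child → Child → Set
ModalCopy Γ v = ∃₂ λ seg v′ → All (CopyOf Γ) seg × seg ⇉◇ [ v′ ] × Labelled _≽_ v′ v

modal-copies : (∀ {v} → CopyOf Γ′ v → ModalCopy Γ v) → All (CopyOf Γ′) ys →
               ∃₂ λ zs ys′ → All (CopyOf Γ) zs × zs ⇉◇ ys′ × ys′ ≽ᶜ ys
modal-copies f []       = [] , [] , [] , (λ _ → ε) , []
modal-copies f (o ∷ os) with f o | modal-copies f os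
... | seg , v′ , seg-copies , seg⇉ , r | zs , ys′ , zs-copies , zs⇉ , rs =
  seg ++ zs , v′ ∷ ys′ , All.++⁺ seg-copies zs-copies , seg++zs⇉ , r ∷ rs
  where
  seg++zs⇉ : seg ++ zs ⇉◇ v′ ∷ ys′
  seg++zs⇉ post = cast-children _↪◇*_ (sym (++-assoc seg zs post)) refl (seg⇉ (zs ++ post))
                  ◅◅ ◂-↪* modal⇒¬replicative (zs⇉ post)

unchanged-copy : Γ ⊆ Γ′ → CopyOf Γ v → ModalCopy Γ′ v
unchanged-copy {v = a , Y} Γ⊆Γ′ o = [ a , Y ] , _ , CopyOf-⊆ Γ⊆Γ′ o ∷ [] , (λ _ → ε) , ⟨ ≽-refl Y ⟩

partition-copies : ∀ Γ → All (CopyOf (Γ ∷ʳ (β , S))) zs →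
                   ∃₂ λ zs₁ Es → All (CopyOf Γ) zs₁ × All (S ⊑_) Es × zs₁ ++ map (β ,_) Es ↭ zs
partition-copies Γ []       = [] , [] , [] , [] , ↭-refl
partition-copies Γ (o ∷ os) with partition-copies Γ os | Any.++⁻ Γ o
... | zs₁ , Es , os₁ , Es⊒ , p | inj₁ o′           = _ ∷ zs₁ , Es , o′ ∷ os₁ , Es⊒ , prep _ p
... | zs₁ , Es , os₁ , Es⊒ , p | inj₂ (here ⟨ r ⟩) = zs₁ , _ ∷ Es , os₁ , r ∷ Es⊒ , ↭-trans (↭.shift _ zs₁ _) (prep _ p)

⊑-∷ʳ⁻ : node Δ̃ (Γ̃ ∷ʳ (β , S)) ⊑ V →
        ∃[ Lt ] ∃[ Se ] ∃[ Es ] node Δ̃ Γ̃ ⊑ node Δ̃ Lt × S ⊑ Se × All (S ⊑_) Es × node Δ̃ (Lt ++ map (β ,_) (Se ∷ Es)) ≽ V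
⊑-∷ʳ⁻ {Γ̃ = Γ̃} {β = β} (node {ys = zs} copies qs) with Pointwise-splitˡ Γ̃ qs
... | Γe , _ , refl , qs₁ , ⟨_⟩ {S′ = Se} q ∷ [] with partition-copies Γ̃ copies
... | zs₁ , Es , copies₁ , Es⊒ , p = zs₁ ++ Γe , _ , Es , node copies₁ qs₁ , q , Es⊒ , node id reorder (≽ᶜ-refl _)
  where
  open ↭.PermutationReasoning
  y₀ : Child
  y₀ = (β , Se)
  M : List Child
  M = map (β ,_) Es
  reorder : (zs₁ ++ Γe) ++ y₀ ∷ M ↭ zs ++ Γe ++ [ y₀ ]
  reorder = begin
    (zs₁ ++ Γe) ++ y₀ ∷ M      ≡⟨ ++-assoc zs₁ Γe _ ⟩
    zs₁ ++ Γe ++ y₀ ∷ M        ≡⟨ cong (zs₁ ++_) (sym (++-assoc Γe [ y₀ ] M)) ⟩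
    zs₁ ++ (Γe ++ [ y₀ ]) ++ M ↭⟨ ↭.++⁺ˡ zs₁ (↭.++-comm (Γe ++ [ y₀ ]) M) ⟩
    zs₁ ++ M ++ Γe ++ [ y₀ ]   ≡⟨ sym (++-assoc zs₁ M _) ⟩
    (zs₁ ++ M) ++ Γe ++ [ y₀ ] ↭⟨ ↭.++⁺ʳ _ p ⟩
    zs ++ Γe ++ [ y₀ ]         ∎

absorb : β < α → ∀ Es mid {L} post →
         node Δ (map (β ,_) Es ++ mid ++ (α , node Δ̃ L) ∷ post) ↪◇*
         node Δ (mid ++ (α , node Δ̃ (L ++ map (β ,_) Es)) ∷ post)
absorb β<α []       mid {L} post = cast-children _↪◇*_ refl (cong (λ L′ → mid ++ (_ , node _ L′) ∷ post) (sym (++-identityʳ L))) ε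
absorb {β = β} β<α (e ∷ Es) mid {L} post =
  cast-children _↪◇*_ (cong (_ ∷_) (++-assoc (map (β ,_) Es) mid _)) (++-assoc (map (β ,_) Es) mid _)
    (step* J (J← [] (map (β ,_) Es ++ mid) post β<α))
  ◅◅ cast-children _↪◇*_ refl (cong (λ L′ → mid ++ (_ , node _ L′) ∷ post) (++-assoc L _ _))
       (absorb β<α Es mid {L ∷ʳ (β , e)} post)

copy-under-λ : ∀ as bs → β < α → CopyOf (as ++ (β , S) ∷ bs) v → ModalCopy (as ++ (α , S) ∷ bs) v
copy-under-λ as bs β<α o with Any-middle⁻ as bs o
... | inj₁ ⟨ r ⟩ = [ _ , _ ] , _ , ∈⇒CopyOf (∈-insert as) r ∷ [] , (λ post → step* λ' (λ' [] post β<α)) , ⟨ ≽-refl _ ⟩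
... | inj₂ o′    = unchanged-copy (⊆-insert as bs) o′

copy-under-J : β < α → ∀ P Q → P ++ Q ≡ as ++ (α , node Δ̃ Γ̃) ∷ bs →
               CopyOf (as ++ (α , node Δ̃ (Γ̃ ∷ʳ (β , S))) ∷ bs) v → ModalCopy (P ++ (β , S) ∷ Q) v
copy-under-J {as = as} {bs = bs} β<α P Q eq o with Any-middle⁻ as bs o
... | inj₂ o′    = unchanged-copy (⊆-insert P Q ∘ subst (_ ∈_) (sym eq) ∘ ⊆-insert as bs) o′
... | inj₁ ⟨ r ⟩ with ⊑-∷ʳ⁻ r
... | Lt , Se , Es , rN , rS , Es⊒ , r≽ =
  map (_ ,_) (Se ∷ Es) ++ [ _ , node _ Lt ] , _ ,
  All.++⁺ (All.map⁺ (All.map (∈⇒CopyOf (∈-insert P)) (rS ∷ Es⊒)))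
          (∈⇒CopyOf (⊆-insert P Q (subst (_ ∈_) (sym eq) (∈-insert as))) rN ∷ []) ,
  (λ post → cast-children _↪◇*_ (sym (++-assoc (map (_ ,_) (Se ∷ Es)) _ post)) refl (absorb β<α (Se ∷ Es) [] post)) ,
  ⟨ r≽ ⟩

⊑◇*≽-intro : All (CopyOf Γ) (zs ++ xs) → Γ ⊑ᶜ Γw → zs ⇉◇ ys′ → node Δ (xs ++ Γw) ↪◇* node Δ Γw′ →
           ys′ ≽ᶜ ys → Γw′ ≽ᶜ Γ′ → (_⊑_ ⨾ _↪◇*_ ⨾ _≽_) (node Δ Γ) (node Δ (ys ++ Γ′))
⊑◇*≽-intro {zs = zs} {xs} {Γw = Γw} copies qs zs⇉ steps rs rs′ =
  _ , cast-children _⊑_ refl (++-assoc zs xs Γw) (node copies qs) ,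
  _ , zs⇉ (xs ++ Γw) ◅◅ ++ˡ-↪◇* _ steps , node id ↭-refl (Pointwise.++⁺ rs rs′)

J⊑⇒⊑◇*≽ : ∀ P Q ls ms → P ++ Q ≡ ls ++ (α , node Δ̃ Γ̃) ∷ ms → β < α →
          node Δ (ls ++ (α , node Δ̃ (Γ̃ ∷ʳ (β , S))) ∷ ms) ⊑ V →
          (_⊑_ ⨾ _↪◇*_ ⨾ _≽_) (node Δ (P ++ (β , S) ∷ Q)) V
J⊑⇒⊑◇*≽ {α = α} {Δ̃ = Δ̃} {β = β} {Δ = Δ} {S = S} P Q ls ms eq β<α (node copies qs) with Pointwise-splitˡ ls qs
... | ls′ , _ ∷ ms′ , refl , qs₁ , ⟨ qN ⟩ ∷ qs₂ with ⊑-∷ʳ⁻ qN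
... | Lt , Se , Es , qΓ̃ , qS , Es⊒ , r≽
  with Pointwise-splitˡ P (subst (_⊑ᶜ _) (sym eq) (Pointwise.++⁺ qs₁ (⟨ qΓ̃ ⟩ ∷ qs₂)))
... | P′ , Q′ , eq′ , qP , qQ with modal-copies (copy-under-J β<α P Q eq) copies
... | zs , ys′ , copies′ , zs⇉ , rs =
  ⊑◇*≽-intro (All.++⁺ copies′ extras) (Pointwise.++⁺ qP (⟨ qS ⟩ ∷ qQ)) zs⇉ steps rs
    (Pointwise.++⁺ (≽ᶜ-refl ls′) (⟨ subst (λ L → node Δ̃ L ≽ _) (sym (++-assoc Lt _ _)) r≽ ⟩ ∷ ≽ᶜ-refl ms′))
  where
  extras : All (CopyOf (P ++ (β , S) ∷ Q)) (map (β ,_) Es)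
  extras = All.map⁺ (All.map (∈⇒CopyOf (∈-insert P)) Es⊒)

  steps : node Δ (map (β ,_) Es ++ P′ ++ (β , Se) ∷ Q′) ↪◇*
          node Δ (ls′ ++ (α , node Δ̃ ((Lt ∷ʳ (β , Se)) ++ map (β ,_) Es)) ∷ ms′)
  steps = ++ˡ-↪◇* (map (β ,_) Es) (step* J (J-between P′ Q′ ls′ ms′ (sym eq′) β<α)) ◅◅ absorb β<α Es ls′ ms′

mutual
  ◇⊑⇒⊑◇*≽ : Modal μ → T ⇀[ μ ] U → U ⊑ V → (_⊑_ ⨾ _↪◇*_ ⨾ _≽_) T V
  ◇⊑⇒⊑◇*≽ λ' (λ' as bs β<α) (node copies qs) with Pointwise-splitˡ as qs
  ... | gs , _ , refl , qs₁ , ⟨ q ⟩ ∷ qs₂ with modal-copies (copy-under-λ as bs β<α) copies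
  ... | zs , ys′ , copies′ , zs⇉ , rs =
    ⊑◇*≽-intro (All.++⁺ copies′ []) (Pointwise.++⁺ qs₁ (⟨ q ⟩ ∷ qs₂)) zs⇉ (step* λ' (λ' gs _ β<α)) rs (≽ᶜ-refl _)
  ◇⊑⇒⊑◇*≽ J (J→ {Δ = Δ} as bs cs β<α) q =
    subst (λ L → (_⊑_ ⨾ _↪◇*_ ⨾ _≽_) (node Δ L) _) (++-assoc as _ _)
      (J⊑⇒⊑◇*≽ (as ++ _ ∷ bs) cs as (bs ++ cs) (++-assoc as _ cs) β<α q)
  ◇⊑⇒⊑◇*≽ J (J← {Δ = Δ} as bs cs β<α) q =
    J⊑⇒⊑◇*≽ as (bs ++ _ ∷ cs) (as ++ bs) cs (sym (++-assoc as bs _)) β<α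
      (subst (λ L → node Δ L ⊑ _) (sym (++-assoc as bs _)) q)
  ◇⊑⇒⊑◇*≽ m (inside as a bs s) (node copies qs) with Pointwise-splitˡ as qs
  ... | gs , _ , refl , qs₁ , ⟨ q ⟩ ∷ qs₂ with ◇⊑⇒⊑◇*≽ m s q | modal-copies (copy-under-inside as a bs m s) copies
  ... | _ , q′ , _ , steps , r | zs , ys′ , copies′ , zs⇉ , rs =
    ⊑◇*≽-intro (All.++⁺ copies′ []) (Pointwise.++⁺ qs₁ (⟨ q′ ⟩ ∷ qs₂)) zs⇉ (inside* gs a _ steps) rs (≽ᶜ-at gs a _ r)

  copy-under-inside : ∀ as a bs → Modal μ → S ⇀[ μ ] S′ → CopyOf (as ++ (a , S′) ∷ bs) v → ModalCopy (as ++ (a , S) ∷ bs) v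
  copy-under-inside as a bs m s o with Any-middle⁻ as bs o
  ... | inj₂ o′    = unchanged-copy (⊆-insert as bs) o′
  ... | inj₁ ⟨ r ⟩ with ◇⊑⇒⊑◇*≽ m s r
  ... | _ , r′ , _ , steps , r″ =
    [ a , _ ] , _ , ∈⇒CopyOf (∈-insert as) r′ ∷ [] , (λ post → inside* [] a post steps) , ⟨ r″ ⟩

NormalForm : MTree → MTree → Set
NormalForm = _⊑_ ⨾ _↪◇*_ ⨾ _⊳_ ⨾ _≽_

NormalForm-refl : ∀ T → NormalForm T T
NormalForm-refl T = T , ⊑-refl T , T , ε , T , ⊳-refl T , ≽-refl T

≽-NormalForm : T ≽ U → NormalForm U V → NormalForm T V
≽-NormalForm r (_ , q , _ , steps , _ , n , r′) with ≽⊑⇒⊑≽ r q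
... | A , q′ , r₁ with ≽◇*⇒◇*≽ r₁ steps
... | B , steps′ , r₂ with ≽⊳⇒⊳≽ r₂ n
... | C , n′ , r₃ = A , q′ , B , steps′ , C , n′ , ≽-trans r₃ r′

◇-NormalForm : Modal μ → T ⇀[ μ ] U → NormalForm U V → NormalForm T V
◇-NormalForm m s (_ , q , _ , steps , _ , n , r) with ◇⊑⇒⊑◇*≽ m s q
... | A , q′ , _ , steps₁ , r₁ with ≽◇*⇒◇*≽ r₁ steps
... | B , steps₂ , r₂ with ≽⊳⇒⊳≽ r₂ n
... | C , n′ , r₃ = A , q′ , B , steps₁ ◅◅ steps₂ , C , n′ , ≽-trans r₃ r

⊳-NormalForm : T ⊳ U → NormalForm U V → NormalForm T V
⊳-NormalForm n (_ , q , _ , steps , C , n′ , r) with ⊳⊑⇒⊑⊳ n q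
... | A , q′ , n₁ with ⊳◇*⇒◇*⊳ n₁ steps
... | B , steps′ , n₂ = A , q′ , B , steps′ , C , ⊳-trans n₂ n′ , r

⇀-NormalForm : T ⇀[ μ ] U → NormalForm U V → NormalForm T V
⇀-NormalForm {μ = ρ⁺} s = ≽-NormalForm (⇀⇒≽ (inj₁ ρ⁺) s)
⇀-NormalForm {μ = ρ⁻} s = ≽-NormalForm (⇀⇒≽ (inj₁ ρ⁻) s)
⇀-NormalForm {μ = σ}  s = ≽-NormalForm (⇀⇒≽ (inj₂ σ) s)
⇀-NormalForm {μ = π⁺} s (A , q , rest) = A , π⁺-⊑ s q , rest
⇀-NormalForm {μ = π⁻} s = ⊳-NormalForm (⇀⇒⊳ π⁻ s)
⇀-NormalForm {μ = 𝔯4} s = ⊳-NormalForm (⇀⇒⊳ 𝔯4 s)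
⇀-NormalForm {μ = λ'} s = ◇-NormalForm λ' s
⇀-NormalForm {μ = J}  s = ◇-NormalForm J s

↪*⇒NormalForm : T ↪* U → NormalForm T U
↪*⇒NormalForm ε                = NormalForm-refl _
↪*⇒NormalForm ((_ , s) ◅ steps) = ⇀-NormalForm (Step⇒⇀ s) (↪*⇒NormalForm steps)

NormalForm⇒Seq : NormalForm T U → ∃[ Ω ] Normal Ω × Seq Ω T U
NormalForm⇒Seq (_ , q , _ , steps , _ , n , r) with ≽⇒ρ*σ* r
... | _ , ρs , σs with ↪*⇒Seq (⊑⇒↪* q) | ↪*⇒Seq steps | ↪*⇒Seq (⊳⇒↪* n) | ↪*⇒Seq ρs | ↪*⇒Seq σs
... | Ωπ , kπ , sπ | Ω◇ , k◇ , s◇ | Ωδ , kδ , sδ | Ωρ , kρ , sρ | Ωσ , kσ , sσ =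
  _ , (Ωπ , Ω◇ , Ωδ , Ωρ , Ωσ , kπ , k◇ , kδ , kρ , kσ , refl) ,
  Seq-++ sπ (Seq-++ s◇ (Seq-++ sδ (Seq-++ sρ sσ)))

mainTheorem3 : (T S : MTree) → T ↪* S →
    Σ (List Rule) λ Ω → Normal Ω × Seq Ω T S
mainTheorem3 T S steps = NormalForm⇒Seq (↪*⇒NormalForm steps)
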